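{- Let $D=(V,A)$ be a digraph and let $v\in V$ with out-degree $d^+(v)=0$. Then $\gamma^+_{maj}(D)-1\leq \gamma^+_{maj}(D-v)$, where $D-v$ is the digraph obtained by deleting $v$ and all arcs incident with it.
   Context: Digraphs are finite, without loops or multiple arcs (pairs of opposite arcs allowed). For $u\in V$, $N^+[u]=\{u\}\cup\{v: uv\in A\}$ and $d^+(u)=|N^+[u]|-1$. For $f:V\to\{ -1,1\}$ and $X\subseteq V$, $f(X)=\sum_{v\in X}f(v)$. A majority out-dominating function (MODF) of $D$ is a function $f:V\to\{ -1,1\}$ with $|\{v\in V: f(N^+[v])\geq1\}|\geq |V|/2$; its weight is $w(f)=f(V)$. $\gamma^+_{maj}(D)$ is the minimum weight of a MODF of $D$. -}

module Defs where

open import Data.Nat using (ℕ; zero; suc) renaming (_+_ to _+ℕ_; _*_ to _*ℕ_; _≤_ to _≤ℕ_)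
open import Data.Bool using (Bool; true; false; if_then_else_)
open import Data.Fin using (Fin; zero; suc; punchIn)
open import Data.Integer using (ℤ; _+_; _≤_; -_; +_; 1ℤ; 0ℤ; _≤?_)
open import Data.Sign using (Sign)
open import Data.Product using (Σ; _×_)
open import Relation.Nullary using (does)
open import Relation.Binary.PropositionalEquality using (_≡_)

-- A digraph on vertex set Fin n: arc relation (decidable, Bool-valued),
-- no loops; pairs of opposite arcs are allowed, no multiple arcs by construction.
record Digraph (n : ℕ) : Set where
  field
    arc   : Fin n → Fin n → Bool
    noLoop : ∀ i → arc i i ≡ false
open Digraph public

Σℤ : (n : ℕ) → (Fin n → ℤ) → ℤ
Σℤ zero    g = 0ℤ
Σℤ (suc n) g = g zero + Σℤ n (λ i → g (suc i))

count : (n : ℕ) → (Fin n → Bool) → ℕ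
count zero    p = 0
count (suc n) p = (if p zero then 1 else 0) +ℕ count n (λ i → p (suc i))

SignFun : ℕ → Set
SignFun n = Fin n → Sign

val : Sign → ℤ
val Sign.+ = 1ℤ
val Sign.- = - 1ℤ

weight : ∀ {n} → SignFun n → ℤ
weight {n} f = Σℤ n (λ i → val (f i))

-- f(N⁺[u]) = f(u) + Σ_{u→j} f(j)   (no loops, so u is counted once)
closedOutSum : ∀ {n} → Digraph n → SignFun n → Fin n → ℤ
closedOutSum {n} D f u =
  val (f u) + Σℤ n (λ j → if arc D u j then val (f j) else 0ℤ)

dominated : ∀ {n} → Digraph n → SignFun n → Fin n → Bool
dominated D f u = does (1ℤ ≤? closedOutSum D f u)

-- MODF: |{u : f(N⁺[u]) ≥ 1}| ≥ |V|/2, i.e. 2·count ≥ n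
IsMODF : ∀ {n} → Digraph n → SignFun n → Set
IsMODF {n} D f = n ≤ℕ 2 *ℕ count n (dominated D f)

IsMajOutDomNumber : ∀ {n} → Digraph n → ℤ → Set
IsMajOutDomNumber D k =
  Σ (SignFun _) (λ f → IsMODF D f × weight f ≡ k)
  × (∀ f → IsMODF D f → k ≤ weight f)

outDegreeZero : ∀ {n} → Digraph n → Fin n → Set
outDegreeZero {n} D v = ∀ j → arc D v j ≡ false

-- D - v : delete v and all incident arcs; vertices of D - v are Fin n,
-- embedded into Fin (suc n) by punchIn v (skipping v)
deleteVertex : ∀ {n} → Digraph (suc n) → Fin (suc n) → Digraph n
deleteVertex D v = record
  { arc    = λ i j → arc D (punchIn v i) (punchIn v j)
  ; noLoop = λ i → noLoop D (punchIn v i)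
  }

module Submission where

-- Let g be a minimum-weight MODF of D - v and extend it to D by
-- giving the sink v the value +1.  The extension f has weight 1 + γ(D - v).
-- Since v has no out-neighbours, f(N⁺[v]) = f(v) = 1, so v is dominated; and
-- for every other vertex u, f(N⁺[u]) equals g(N⁺[u]) in D - v plus the
-- non-negative contribution of a possible arc u → v, so every vertex dominated
-- by g stays dominated by f.  Hence f dominates at least one vertex more than
-- g, which turns |V(D - v)| ≤ 2·#dominated into |V(D)| ≤ 2·#dominated: f is a
-- MODF of D and γ(D) ≤ 1 + γ(D - v).

open import Defs
open import Data.Nat using (ℕ; suc)
open import Data.Fin using (Fin)
open import Data.Integer using (ℤ; _-_; _≤_; 1ℤ)

open import Data.Nat using (zero; z≤n; s≤s) renaming (_+_ to _+ℕ_; _*_ to _*ℕ_; _≤_ to _≤ℕ_)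
import Data.Nat.Properties as ℕP
open import Data.Fin using (zero; suc; punchIn)
open import Data.Integer using (_+_; 0ℤ; -1ℤ; _≤?_; pred) renaming (suc to sucℤ)
import Data.Integer.Properties as ℤP
open import Algebra.Properties.CommutativeSemigroup ℤP.+-commutativeSemigroup using (x∙yz≈y∙xz)
open import Algebra.Properties.CommutativeSemigroup ℕP.+-commutativeSemigroup as ℕSemigroup using ()
open import Data.Empty using (⊥-elim)
open import Data.Sign using (Sign)
open import Data.Bool using (Bool; true; false; T; if_then_else_)
open import Data.Product using (_,_)
open import Data.Vec.Functional using (insertAt)
open import Data.Vec.Functional.Properties using (insertAt-lookup; insertAt-punchIn)
open import Relation.Nullary.Decidable using (does; yes; no)
open import Relation.Binary.PropositionalEquality using (_≡_; refl; trans; cong; cong₂; subst; module ≡-Reasoning)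

Σℤ-cong : ∀ n {g h : Fin n → ℤ} → (∀ i → g i ≡ h i) → Σℤ n g ≡ Σℤ n h
Σℤ-cong zero    eq = refl
Σℤ-cong (suc n) eq = cong₂ _+_ (eq zero) (Σℤ-cong n (λ i → eq (suc i)))

Σℤ-zero : ∀ n {g : Fin n → ℤ} → (∀ i → g i ≡ 0ℤ) → Σℤ n g ≡ 0ℤ
Σℤ-zero zero    eq = refl
Σℤ-zero (suc n) eq = cong₂ _+_ (eq zero) (Σℤ-zero n (λ i → eq (suc i)))

Σℤ-split : ∀ n (v : Fin (suc n)) (h : Fin (suc n) → ℤ) →
           Σℤ (suc n) h ≡ h v + Σℤ n (λ i → h (punchIn v i))
Σℤ-split n       zero    h = refl
Σℤ-split (suc n) (suc v) h = begin
  h zero + Σℤ (suc n) (λ i → h (suc i))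
    ≡⟨ cong (h zero +_) (Σℤ-split n v (λ i → h (suc i))) ⟩
  h zero + (h (suc v) + Σℤ n (λ i → h (suc (punchIn v i))))
    ≡⟨ x∙yz≈y∙xz (h zero) (h (suc v)) _ ⟩
  h (suc v) + (h zero + Σℤ n (λ i → h (suc (punchIn v i))))
    ∎
  where open ≡-Reasoning

count-split : ∀ n (v : Fin (suc n)) (p : Fin (suc n) → Bool) →
              count (suc n) p ≡ (if p v then 1 else 0) +ℕ count n (λ i → p (punchIn v i))
count-split n       zero    p = refl
count-split (suc n) (suc v) p = begin
  a +ℕ count (suc n) (λ i → p (suc i))
    ≡⟨ cong (a +ℕ_) (count-split n v (λ i → p (suc i))) ⟩
  a +ℕ (b +ℕ count n (λ i → p (suc (punchIn v i))))
    ≡⟨ ℕSemigroup.x∙yz≈y∙xz a b _ ⟩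
  b +ℕ (a +ℕ count n (λ i → p (suc (punchIn v i))))
    ∎
  where
  open ≡-Reasoning
  a = if p zero then 1 else 0
  b = if p (suc v) then 1 else 0

count-mono : ∀ n {p q : Fin n → Bool} → (∀ i → T (p i) → T (q i)) → count n p ≤ℕ count n q
count-mono zero    imp = z≤n
count-mono (suc n) {p} {q} imp with p zero | q zero | imp zero
... | true  | true  | _  = s≤s (count-mono n (λ i → imp (suc i)))
... | true  | false | pq = ⊥-elim (pq _)
... | false | true  | _  = ℕP.m≤n⇒m≤1+n (count-mono n (λ i → imp (suc i)))
... | false | false | _  = count-mono n (λ i → imp (suc i))

at-least-half-suc : ∀ {n c c′} → n ≤ℕ 2 *ℕ c′ → suc c′ ≤ℕ c → suc n ≤ℕ 2 *ℕ c
at-least-half-suc {n} {c} {c′} n≤2c′ c′<c = begin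
  suc n          ≤⟨ s≤s n≤2c′ ⟩
  suc (2 *ℕ c′)  ≤⟨ ℕP.n≤1+n _ ⟩
  2 +ℕ 2 *ℕ c′   ≡⟨ ℕP.*-suc 2 c′ ⟨
  2 *ℕ suc c′    ≤⟨ ℕP.*-monoʳ-≤ 2 c′<c ⟩
  2 *ℕ c         ∎
  where open ℕP.≤-Reasoning

dominates-mono : ∀ {a b : ℤ} → a ≤ b → T (does (1ℤ ≤? a)) → T (does (1ℤ ≤? b))
dominates-mono {a} {b} a≤b dom with 1ℤ ≤? a | 1ℤ ≤? b
... | _         | yes _   = _
... | yes 1≤a   | no 1≰b  = 1≰b (ℤP.≤-trans 1≤a a≤b)
... | no _      | no _    = dom

closedOutSum-deleteVertex :
  ∀ {n} (D : Digraph (suc n)) (v : Fin (suc n)) (f : SignFun (suc n)) (g : SignFun n) →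
  (∀ i → f (punchIn v i) ≡ g i) → ∀ i →
  closedOutSum D f (punchIn v i)
    ≡ (if arc D (punchIn v i) v then val (f v) else 0ℤ) + closedOutSum (deleteVertex D v) g i
closedOutSum-deleteVertex {n} D v f g f≗g i = begin
  val (f u) + Σℤ (suc n) h
    ≡⟨ cong₂ _+_ (cong val (f≗g i)) (Σℤ-split n v h) ⟩
  val (g i) + (h v + Σℤ n (λ j → h (punchIn v j)))
    ≡⟨ x∙yz≈y∙xz (val (g i)) (h v) _ ⟩
  h v + (val (g i) + Σℤ n (λ j → h (punchIn v j)))
    ≡⟨ cong (λ s → h v + (val (g i) + s)) (Σℤ-cong n arcs-agree) ⟩
  h v + closedOutSum (deleteVertex D v) g i
    ∎
  where
  open ≡-Reasoning
  u = punchIn v i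
  h : Fin (suc n) → ℤ
  h j = if arc D u j then val (f j) else 0ℤ
  arcs-agree : ∀ j → h (punchIn v j) ≡ (if arc D u (punchIn v j) then val (g j) else 0ℤ)
  arcs-agree j = cong (λ s → if arc D u (punchIn v j) then val s else 0ℤ) (f≗g j)

closedOutSum-sink : ∀ {n} (D : Digraph n) (f : SignFun n) (v : Fin n) →
                    outDegreeZero D v → closedOutSum D f v ≡ val (f v)
closedOutSum-sink {n} D f v sink = begin
  val (f v) + Σℤ n (λ j → if arc D v j then val (f j) else 0ℤ)
    ≡⟨ cong (val (f v) +_) (Σℤ-zero n no-arc) ⟩
  val (f v) + 0ℤ
    ≡⟨ ℤP.+-identityʳ (val (f v)) ⟩
  val (f v)
    ∎
  where
  open ≡-Reasoning
  no-arc : ∀ j → (if arc D v j then val (f j) else 0ℤ) ≡ 0ℤ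
  no-arc j = cong (λ b → if b then val (f j) else 0ℤ) (sink j)

weight-insertAt : ∀ {n} (g : SignFun n) (v : Fin (suc n)) (s : Sign) →
                  weight (insertAt g v s) ≡ val s + weight g
weight-insertAt {n} g v s = begin
  Σℤ (suc n) (λ j → val (f j))
    ≡⟨ Σℤ-split n v (λ j → val (f j)) ⟩
  val (f v) + Σℤ n (λ i → val (f (punchIn v i)))
    ≡⟨ cong₂ _+_ (cong val (insertAt-lookup g v s))
                 (Σℤ-cong n (λ i → cong val (insertAt-punchIn g v s i))) ⟩
  val s + weight g
    ∎
  where
  open ≡-Reasoning
  f = insertAt g v s

≤-arc-to-positive : ∀ (b : Bool) (x : ℤ) → x ≤ (if b then 1ℤ else 0ℤ) + x
≤-arc-to-positive true  x = ℤP.i≤j+i x 1ℤ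
≤-arc-to-positive false x = ℤP.i≤j+i x 0ℤ

insertAt-sink-isMODF : ∀ {n} (D : Digraph (suc n)) (v : Fin (suc n)) →
                       outDegreeZero D v → (g : SignFun n) →
                       IsMODF (deleteVertex D v) g → IsMODF D (insertAt g v Sign.+)
insertAt-sink-isMODF {n} D v sink g g-modf =
  at-least-half-suc g-modf one-more-dominated
  where
  D′ = deleteVertex D v
  f  = insertAt g v Sign.+

  v-dominated : dominated D f v ≡ true
  v-dominated = cong (λ x → does (1ℤ ≤? x))
    (subst (closedOutSum D f v ≡_) (cong val (insertAt-lookup g v Sign.+))
           (closedOutSum-sink D f v sink))

  sum-grows : ∀ i → closedOutSum D′ g i ≤ closedOutSum D f (punchIn v i)
  sum-grows i = begin
    closedOutSum D′ g i
      ≤⟨ ≤-arc-to-positive (arc D u v) _ ⟩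
    (if arc D u v then 1ℤ else 0ℤ) + closedOutSum D′ g i
      ≡⟨ cong (λ s → (if arc D u v then val s else 0ℤ) + closedOutSum D′ g i)
              (insertAt-lookup g v Sign.+) ⟨
    (if arc D u v then val (f v) else 0ℤ) + closedOutSum D′ g i
      ≡⟨ closedOutSum-deleteVertex D v f g (insertAt-punchIn g v Sign.+) i ⟨
    closedOutSum D f u
      ∎
    where
    open ℤP.≤-Reasoning
    u = punchIn v i

  one-more-dominated : suc (count n (dominated D′ g)) ≤ℕ count (suc n) (dominated D f)
  one-more-dominated = begin
    suc (count n (dominated D′ g))
      ≤⟨ s≤s (count-mono n (λ i → dominates-mono (sum-grows i))) ⟩
    suc (count n (λ i → dominated D f (punchIn v i)))
      ≡⟨ cong (λ b → (if b then 1 else 0) +ℕ count n (λ i → dominated D f (punchIn v i)))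
              v-dominated ⟨
    (if dominated D f v then 1 else 0) +ℕ count n (λ i → dominated D f (punchIn v i))
      ≡⟨ count-split n v (dominated D f) ⟨
    count (suc n) (dominated D f)
      ∎
    where open ℕP.≤-Reasoning

proposition3p10 : ∀ {n} (D : Digraph (suc n)) (v : Fin (suc n)) → outDegreeZero D v → (γD γDv : ℤ) → IsMajOutDomNumber D γD → IsMajOutDomNumber (deleteVertex D v) γDv → γD - 1ℤ ≤ γDv
proposition3p10 D v sink γD γDv (_ , γD-minimal) ((g , g-modf , g-weight) , _) = begin
  γD - 1ℤ
    ≡⟨ ℤP.+-comm γD -1ℤ ⟩
  pred γD
    ≤⟨ ℤP.pred-mono γD≤1+γDv ⟩
  pred (sucℤ γDv)
    ≡⟨ ℤP.pred-suc γDv ⟩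
  γDv
    ∎
  where
  open ℤP.≤-Reasoning
  f = insertAt g v Sign.+

  γD≤1+γDv : γD ≤ sucℤ γDv
  γD≤1+γDv = subst (γD ≤_) (trans (weight-insertAt g v Sign.+) (cong (1ℤ +_) g-weight))
                   (γD-minimal f (insertAt-sink-isMODF D v sink g g-modf))
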